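{- For natural numbers $0<k<n$, $${n \brack k}=\sum_{0<i_1<i_2<\cdots<i_k\le n}\ \prod_{j=1}^{k}\binom{i_j}{j}.$$
   Context: The numbers ${n\brack k}$ are defined by ${n\brack 0}=1$, ${n\brack n}=1$, and ${n\brack k}={n-1\brack k}+\binom{n}{k}{n-1\brack k-1}$ for $0<k<n$. -}

module Defs where

open import Data.Nat using (ℕ; zero; suc; _+_; _*_; _≟_)
open import Data.Nat.Combinatorics using (_C_)
open import Data.List using (List; []; _∷_; _++_; map; _∷ʳ_)
open import Data.Nat.ListAction using (sum)
open import Relation.Nullary using (yes; no)

-- The numbers [n k] from the paper:
-- [n 0] = 1, [n n] = 1, [n k] = [n-1 k] + C(n,k) * [n-1 k-1] for 0<k<n.
-- (Values for k > n are not specified by the paper; we set them to 0.)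
bracket : ℕ → ℕ → ℕ
bracket n       zero    = 1
bracket zero    (suc k) = 0
bracket (suc n) (suc k) with n ≟ k
... | yes _ = 1
... | no  _ = bracket n (suc k) + (suc n C suc k) * bracket n k

-- incSeqs n k : all strictly increasing lists [i₁, …, i_k] with
-- 0 < i₁ < i₂ < ⋯ < i_k ≤ n (each exactly once).
incSeqs : ℕ → ℕ → List (List ℕ)
incSeqs n       zero    = [] ∷ []
incSeqs zero    (suc k) = []
incSeqs (suc n) (suc k) = incSeqs n (suc k) ++ map (_∷ʳ suc n) (incSeqs n k)

weightFrom : ℕ → List ℕ → ℕ
weightFrom j []       = 1
weightFrom j (i ∷ is) = (i C j) * weightFrom (suc j) is

weight : List ℕ → ℕ
weight = weightFrom 1

chainSum : ℕ → ℕ → ℕ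
chainSum n k = sum (map weight (incSeqs n k))

-- Both sides satisfy the same Pascal-type recurrence in n with the same boundary values.
-- For the chain sum, split the chains ending below n+1 from those ending at n+1: appending
-- i_{k+1} = n+1 to a chain of length k multiplies its weight by C(n+1, k+1).  For the bracket,
-- the diagonal clause of its definition is an instance of the general recurrence, because
-- [n, n+1] = 0, C(n+1, n+1) = 1 and [n, n] = 1.
module Submission where

open import Defs
open import Data.Nat using (ℕ; zero; suc; _+_; _*_; _<_; _≟_; s≤s)
open import Data.Nat.Properties using (*-assoc; *-comm; *-zeroʳ; *-identityˡ; *-identityʳ; *-distribˡ-+; +-identityʳ; +-suc; <-irrefl; <-trans; n<1+n)
open import Data.Nat.Combinatorics using (_C_; nCn≡1)
open import Data.Nat.ListAction using (sum)
open import Data.Nat.ListAction.Properties using (sum-++)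
open import Data.List using (List; []; _∷_; _++_; map; _∷ʳ_; length)
open import Data.List.Properties using (map-++)
open import Data.List.Relation.Unary.All using (All; []; _∷_)
open import Data.List.Relation.Unary.All.Properties using (++⁺; map⁺)
import Data.List.Relation.Unary.All as All
open import Data.Empty using (⊥-elim)
open import Relation.Nullary using (yes; no)
open import Relation.Binary.PropositionalEquality using (_≡_; refl; sym; trans; cong; cong₂; module ≡-Reasoning)
open ≡-Reasoning

sum-map-*ˡ : ∀ c ns → sum (map (c *_) ns) ≡ c * sum ns
sum-map-*ˡ c []       = sym (*-zeroʳ c)
sum-map-*ˡ c (n ∷ ns) = trans (cong (c * n +_) (sum-map-*ˡ c ns)) (sym (*-distribˡ-+ c n (sum ns)))

length-∷ʳ : ∀ {A : Set} (xs : List A) x → length (xs ∷ʳ x) ≡ suc (length xs)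
length-∷ʳ []       x = refl
length-∷ʳ (_ ∷ xs) x = cong suc (length-∷ʳ xs x)

weightFrom-∷ʳ : ∀ j is i → weightFrom j (is ∷ʳ i) ≡ weightFrom j is * (i C (j + length is))
weightFrom-∷ʳ j []        i = begin
  (i C j) * 1          ≡⟨ *-identityʳ (i C j) ⟩
  i C j                ≡⟨ cong (i C_) (+-identityʳ j) ⟨
  i C (j + 0)          ≡⟨ *-identityˡ (i C (j + 0)) ⟨
  1 * (i C (j + 0))    ∎
weightFrom-∷ʳ j (i′ ∷ is) i = begin
  (i′ C j) * weightFrom (suc j) (is ∷ʳ i)
    ≡⟨ cong ((i′ C j) *_) (weightFrom-∷ʳ (suc j) is i) ⟩
  (i′ C j) * (weightFrom (suc j) is * (i C (suc j + length is)))
    ≡⟨ *-assoc (i′ C j) _ _ ⟨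
  (i′ C j) * weightFrom (suc j) is * (i C (suc j + length is))
    ≡⟨ cong (λ m → (i′ C j) * weightFrom (suc j) is * (i C m)) (+-suc j (length is)) ⟨
  (i′ C j) * weightFrom (suc j) is * (i C (j + suc (length is)))
    ∎

weight-∷ʳ : ∀ is i → weight (is ∷ʳ i) ≡ (i C suc (length is)) * weight is
weight-∷ʳ is i = trans (weightFrom-∷ʳ 1 is i) (*-comm (weight is) _)

incSeqs-length : ∀ n k → All (λ is → length is ≡ k) (incSeqs n k)
incSeqs-length n       zero    = refl ∷ []
incSeqs-length zero    (suc k) = []
incSeqs-length (suc n) (suc k) =
  ++⁺ (incSeqs-length n (suc k))
      (map⁺ (All.map (λ {is} ∣is∣≡k → trans (length-∷ʳ is (suc n)) (cong suc ∣is∣≡k)) (incSeqs-length n k)))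

sum-weight-∷ʳ : ∀ {k} i {iss : List (List ℕ)} → All (λ is → length is ≡ k) iss →
                sum (map weight (map (_∷ʳ i) iss)) ≡ (i C suc k) * sum (map weight iss)
sum-weight-∷ʳ {k} i []                            = sym (*-zeroʳ (i C suc k))
sum-weight-∷ʳ {k} i {is ∷ iss} (∣is∣≡k ∷ lengths) = begin
  weight (is ∷ʳ i) + sum (map weight (map (_∷ʳ i) iss))
    ≡⟨ cong₂ _+_ (weight-∷ʳ is i) (sum-weight-∷ʳ i lengths) ⟩
  (i C suc (length is)) * weight is + (i C suc k) * sum (map weight iss)
    ≡⟨ cong (λ m → (i C suc m) * weight is + _) ∣is∣≡k ⟩
  (i C suc k) * weight is + (i C suc k) * sum (map weight iss)
    ≡⟨ *-distribˡ-+ (i C suc k) _ _ ⟨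
  (i C suc k) * (weight is + sum (map weight iss))
    ∎

chainSum-suc : ∀ n k → chainSum (suc n) (suc k) ≡ chainSum n (suc k) + (suc n C suc k) * chainSum n k
chainSum-suc n k = begin
  sum (map weight (incSeqs n (suc k) ++ map (_∷ʳ suc n) (incSeqs n k)))
    ≡⟨ cong sum (map-++ weight (incSeqs n (suc k)) _) ⟩
  sum (map weight (incSeqs n (suc k)) ++ map weight (map (_∷ʳ suc n) (incSeqs n k)))
    ≡⟨ sum-++ (map weight (incSeqs n (suc k))) _ ⟩
  chainSum n (suc k) + sum (map weight (map (_∷ʳ suc n) (incSeqs n k)))
    ≡⟨ cong (chainSum n (suc k) +_) (sum-weight-∷ʳ (suc n) (incSeqs-length n k)) ⟩
  chainSum n (suc k) + (suc n C suc k) * chainSum n k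
    ∎

bracket-> : ∀ {n k} → n < k → bracket n k ≡ 0
bracket-> {zero}  {suc k} _ = refl
bracket-> {suc n} {suc k} (s≤s n<k) with n ≟ k
... | yes refl = ⊥-elim (<-irrefl refl n<k)
... | no _     = begin
  bracket n (suc k) + (suc n C suc k) * bracket n k
    ≡⟨ cong₂ (λ a b → a + (suc n C suc k) * b) (bracket-> (<-trans n<k (n<1+n k))) (bracket-> n<k) ⟩
  (suc n C suc k) * 0
    ≡⟨ *-zeroʳ (suc n C suc k) ⟩
  0 ∎

bracket-diag : ∀ n → bracket n n ≡ 1
bracket-diag zero    = refl
bracket-diag (suc n) with n ≟ n
... | yes _  = refl
... | no n≢n = ⊥-elim (n≢n refl)

bracket-suc : ∀ n k → bracket (suc n) (suc k) ≡ bracket n (suc k) + (suc n C suc k) * bracket n k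
bracket-suc n k with n ≟ k
... | no _     = refl
... | yes refl = sym (begin
  bracket n (suc n) + (suc n C suc n) * bracket n n
    ≡⟨ cong₂ (λ a b → a + b * bracket n n) (bracket-> (n<1+n n)) (nCn≡1 (suc n)) ⟩
  1 * bracket n n
    ≡⟨ cong (1 *_) (bracket-diag n) ⟩
  1 ∎)

bracket≡chainSum : ∀ n k → bracket n k ≡ chainSum n k
bracket≡chainSum n       zero    = refl
bracket≡chainSum zero    (suc k) = refl
bracket≡chainSum (suc n) (suc k) = begin
  bracket (suc n) (suc k)
    ≡⟨ bracket-suc n k ⟩
  bracket n (suc k) + (suc n C suc k) * bracket n k
    ≡⟨ cong₂ (λ a b → a + (suc n C suc k) * b) (bracket≡chainSum n (suc k)) (bracket≡chainSum n k) ⟩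
  chainSum n (suc k) + (suc n C suc k) * chainSum n k
    ≡⟨ chainSum-suc n k ⟨
  chainSum (suc n) (suc k) ∎

corollary1 : (n k : ℕ) → 0 < k → k < n → bracket n k ≡ chainSum n k
corollary1 n k _ _ = bracket≡chainSum n k
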